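{- Let $G$ be a graph, $X$ a cooperative set in $G$, and $C\subseteq (V(G)\setminus X)\cup\delta^G_1(X)$. Let $D$ be a connected component of $G\setminus(X\cup C)$ that is not anticomplete to $X\setminus C$. Then $X'=\left((X\setminus\delta^G_1(X))\cup N(D)\right)\cap(X\setminus C)$ is cooperative in the graph $G'=G[(N[D]\setminus C)\cup X']$.
   Context: Graphs are finite and simple. For $X\subseteq V(G)$, $N(X)$ is the set of vertices outside $X$ with a neighbor in $X$, and $N[X]=N(X)\cup X$; sets are anticomplete if there are no edges between them. For connected $X\subseteq V(G)$, the boundary $\delta^G(X)=\delta^G_1(X)$ is the set of vertices of $X$ having a neighbor in $V(G)\setminus X$, and $\delta^G_i(X)=\delta^G\left(X\setminus\bigcup_{k<i}\delta^G_k(X)\right)$. A connected set $X$ is cooperative in $G$ if: every vertex of $\delta^G_1(X)$ has a neighbor in $X\setminus\delta^G_1(X)$; every vertex of $\delta^G_2(X)$ has a neighbor in $X\setminus(\delta^G_1(X)\cup\delta^G_2(X))$; and $X\setminus(\delta^G_1(X)\cup\delta^G_2(X))$ is connected. -}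

module Defs where

open import Level using (0ℓ)
open import Data.Nat using (ℕ)
open import Data.Fin using (Fin)
open import Data.Product using (Σ; ∃; ∃-syntax; _×_; _,_)
open import Relation.Nullary using (¬_)
open import Relation.Binary using (Decidable)
open import Relation.Unary using (Pred; _∈_; _∉_; _⊆_; _∪_; _∩_; _∖_; U)
import Data.Fin.Subset as Sub

record Graph (n : ℕ) : Set₁ where
  field
    Adj   : Fin n → Fin n → Set
    adj?  : Decidable Adj
    sym   : ∀ {u v} → Adj u v → Adj v u
    irrefl : ∀ {v} → ¬ Adj v v
open Graph public

VSet : ℕ → Set₁
VSet n = Pred (Fin n) 0ℓ

⟦_⟧ : ∀ {n} → Sub.Subset n → VSet n
⟦ X ⟧ v = v Sub.∈ X

module _ {n : ℕ} (G : Graph n) where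

  data WalkIn (S : VSet n) : Fin n → Fin n → Set where
    stop : ∀ {x} → x ∈ S → WalkIn S x x
    step : ∀ {x y z} → x ∈ S → Adj G x y → WalkIn S y z → WalkIn S x z

  Connected : VSet n → Set
  Connected S = (∃[ v ] v ∈ S) × (∀ {x y} → x ∈ S → y ∈ S → WalkIn S x y)

  N : VSet n → VSet n
  N X v = v ∉ X × ∃[ u ] (u ∈ X × Adj G v u)

  N[_] : VSet n → VSet n
  N[ X ] = N X ∪ X

  Anticomplete : VSet n → VSet n → Set
  Anticomplete X Y = ∀ {x y} → x ∈ X → y ∈ Y → ¬ Adj G x y

  -- The following notions are taken in the induced subgraph G[W].
  module Induced (W : VSet n) where

    δ : VSet n → VSet n
    δ X v = v ∈ X × ∃[ u ] (u ∈ W × u ∉ X × Adj G v u)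

    δ₁ : VSet n → VSet n
    δ₁ X = δ X

    δ₂ : VSet n → VSet n
    δ₂ X = δ (X ∖ δ₁ X)

    record Cooperative (X : VSet n) : Set where
      field
        inside    : X ⊆ W
        connected : Connected X
        coop₁     : ∀ {v} → v ∈ δ₁ X → ∃[ u ] (u ∈ X ∖ δ₁ X × Adj G v u)
        coop₂     : ∀ {v} → v ∈ δ₂ X →
                    ∃[ u ] (u ∈ X ∖ (δ₁ X ∪ δ₂ X) × Adj G v u)
        coreConn  : Connected (X ∖ (δ₁ X ∪ δ₂ X))

  CooperativeIn : VSet n → Set
  CooperativeIn X = Induced.Cooperative U X

  IsComponent : VSet n → VSet n → Set₁
  IsComponent W D = D ⊆ W × Connected D ×
                    (∀ (Y : VSet n) → Y ⊆ W → Connected Y → D ⊆ Y → Y ⊆ D)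

{-# OPTIONS --safe #-}
-- The interior does not move: X′ ∖ δ₁(X′) = X ∖ δ₁(X), boundaries of X′ taken in G′.
-- Every vertex of G′ outside X′ lies in D, so a vertex of X′ seeing D is on the
-- boundary of X′, while interior vertices of X only see X, which misses D.  Hence
-- δ₂(X′) ⊆ δ₂(X), the core X ∖ (δ₁(X) ∪ δ₂(X)) lies in the core of X′, and each
-- condition on X′ follows from the one on X: every vertex of X′ reaches the core
-- of X in at most two steps.
module Submission where

open import Defs
open import Data.Nat using (ℕ)
open import Data.Fin.Subset using (Subset)
open import Data.Fin.Subset.Properties using (_∈?_)
open import Data.Fin.Properties using (any?)
open import Data.Product using (∃-syntax; _×_; _,_; proj₁; proj₂)
open import Data.Sum using (inj₁; inj₂)
open import Data.Unit using (tt)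
open import Data.Empty using (⊥-elim)
open import Function using (_∘_)
open import Relation.Nullary using (¬_; yes; no)
open import Relation.Nullary.Decidable using (_×-dec_; decidable-stable)
open import Relation.Binary.PropositionalEquality using (refl)
open import Relation.Unary
  using (_∈_; _∉_; _⊆_; _≐_; _∪_; _∩_; _∖_; ∁; U; ｛_｝; Decidable)
open import Relation.Unary.Properties using (U?; ∁?; _∩?_; _∪?_)

module _ {n : ℕ} (G : Graph n) where

  walk-head : ∀ {S x y} → WalkIn G S x y → x ∈ S
  walk-head (stop x∈S)     = x∈S
  walk-head (step x∈S _ _) = x∈S

  walk-weaken : ∀ {S T x y} → S ⊆ T → WalkIn G S x y → WalkIn G T x y
  walk-weaken S⊆T (stop x∈S)      = stop (S⊆T x∈S)
  walk-weaken S⊆T (step x∈S xy w) = step (S⊆T x∈S) xy (walk-weaken S⊆T w)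

  infixr 5 _++ʷ_
  _++ʷ_ : ∀ {S x y z} → WalkIn G S x y → WalkIn G S y z → WalkIn G S x z
  stop _        ++ʷ w′ = w′
  step x∈S xy w ++ʷ w′ = step x∈S xy (w ++ʷ w′)

  walk-reverse : ∀ {S x y} → WalkIn G S x y → WalkIn G S y x
  walk-reverse (stop x∈S)      = stop x∈S
  walk-reverse (step x∈S xy w) =
    walk-reverse w ++ʷ step (walk-head w) (sym G xy) (stop x∈S)

  connected-via-hub : ∀ {S H} → Connected G H → H ⊆ S →
    (∀ {v} → v ∈ S → ∃[ h ] (h ∈ H × WalkIn G S v h)) → Connected G S
  connected-via-hub {S} ((h , h∈H) , H-walks) H⊆S reach =
    (h , H⊆S h∈H) , walk
    where
    walk : ∀ {x y} → x ∈ S → y ∈ S → WalkIn G S x y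
    walk x∈S y∈S with reach x∈S | reach y∈S
    ... | hx , hx∈H , x→hx | hy , hy∈H , y→hy =
      x→hx ++ʷ walk-weaken H⊆S (H-walks hx∈H hy∈H) ++ʷ walk-reverse y→hy

  connected-add-neighbour : ∀ {D w} → Connected G D → w ∈ N G D →
    Connected G (D ∪ ｛ w ｝)
  connected-add-neighbour {D} {w} D-conn (_ , u , u∈D , wu) =
    connected-via-hub D-conn inj₁ reach
    where
    reach : ∀ {v} → v ∈ D ∪ ｛ w ｝ → ∃[ h ] (h ∈ D × WalkIn G (D ∪ ｛ w ｝) v h)
    reach {v} (inj₁ v∈D) = v , v∈D , stop (inj₁ v∈D)
    reach (inj₂ refl)    = u , u∈D , step (inj₂ refl) wu (stop (inj₁ u∈D))

  component-neighbours-outside : ∀ {A D} → IsComponent G A D → N G D ⊆ ∁ A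
  component-neighbours-outside {A} {D} (D⊆A , D-conn , D-maximal)
                               {w} w∈ND@(w∉D , _) w∈A =
    w∉D (D-maximal (D ∪ ｛ w ｝) D∪w⊆A (connected-add-neighbour D-conn w∈ND)
                   inj₁ (inj₂ refl))
    where
    D∪w⊆A : D ∪ ｛ w ｝ ⊆ A
    D∪w⊆A (inj₁ v∈D) = D⊆A v∈D
    D∪w⊆A (inj₂ refl) = w∈A

  δ? : ∀ {W Y} → Decidable W → Decidable Y → Decidable (Induced.δ G W Y)
  δ? W? Y? v = Y? v ×-dec any? (W? ∩? ∁? Y? ∩? adj? G v)

  δ-mono : ∀ {W W′ Y Z} → W ⊆ W′ → Y ≐ Z → Induced.δ G W Y ⊆ Induced.δ G W′ Z
  δ-mono W⊆W′ (Y⊆Z , Z⊆Y) (v∈Y , u , u∈W , u∉Y , vu) =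
    Y⊆Z v∈Y , u , W⊆W′ u∈W , (λ u∈Z → u∉Y (Z⊆Y u∈Z)) , vu

  module _ {W : VSet n} where
    open Induced G W

    interior-neighbours-inside : ∀ {X v u} → Decidable X → v ∈ X ∖ δ₁ X →
      u ∈ W → Adj G v u → u ∈ X
    interior-neighbours-inside X? (v∈X , v∉δ₁) u∈W vu =
      decidable-stable (X? _) (λ u∉X → v∉δ₁ (v∈X , _ , u∈W , u∉X , vu))

    interior-reaches-core : ∀ {X S} → Cooperative X → Decidable (δ₂ X) →
      X ∖ (δ₁ X ∪ δ₂ X) ⊆ S → ∀ {v} → v ∈ X ∖ δ₁ X → v ∈ S →
      ∃[ k ] (k ∈ X ∖ (δ₁ X ∪ δ₂ X) × WalkIn G S v k)
    interior-reaches-core coop δ₂? core⊆S {v} (v∈X , v∉δ₁) v∈S with δ₂? v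
    ... | yes v∈δ₂ =
      let k , k∈core , vk = Cooperative.coop₂ coop v∈δ₂
      in  k , k∈core , step v∈S vk (stop (core⊆S k∈core))
    ... | no v∉δ₂ = v , (v∈X , λ { (inj₁ v∈δ₁) → v∉δ₁ v∈δ₁
                                 ; (inj₂ v∈δ₂) → v∉δ₂ v∈δ₂ }) , stop v∈S

module _ {n : ℕ} (G : Graph n) (X C D : Subset n)
  (X-coop : CooperativeIn G ⟦ X ⟧)
  (C⊆ : ⟦ C ⟧ ⊆ ∁ ⟦ X ⟧ ∪ Induced.δ₁ G U ⟦ X ⟧)
  (D-component : IsComponent G (∁ (⟦ X ⟧ ∪ ⟦ C ⟧)) ⟦ D ⟧) where

  private
    δ₁X δ₂X interior core X′ V′ δ₁X′ δ₂X′ core′ : VSet n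
    δ₁X      = Induced.δ₁ G U ⟦ X ⟧
    δ₂X      = Induced.δ₂ G U ⟦ X ⟧
    interior = ⟦ X ⟧ ∖ δ₁X
    core     = ⟦ X ⟧ ∖ (δ₁X ∪ δ₂X)
    X′       = (interior ∪ N G ⟦ D ⟧) ∩ (⟦ X ⟧ ∖ ⟦ C ⟧)
    V′       = (N[_] G ⟦ D ⟧ ∖ ⟦ C ⟧) ∪ X′
    δ₁X′     = Induced.δ₁ G V′ X′
    δ₂X′     = Induced.δ₂ G V′ X′
    core′    = X′ ∖ (δ₁X′ ∪ δ₂X′)

    X? : Decidable ⟦ X ⟧
    X? = _∈? X

    δ₂X? : Decidable δ₂X
    δ₂X? = δ? G U? (X? ∩? ∁? (δ? G U? X?))

    D∩X=∅ : ∀ {v} → v ∈ ⟦ D ⟧ → v ∉ ⟦ X ⟧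
    D∩X=∅ v∈D v∈X = proj₁ D-component v∈D (inj₁ v∈X)

    D∩C=∅ : ∀ {v} → v ∈ ⟦ D ⟧ → v ∉ ⟦ C ⟧
    D∩C=∅ v∈D v∈C = proj₁ D-component v∈D (inj₂ v∈C)

    ND⊆X∪C : N G ⟦ D ⟧ ⊆ ⟦ X ⟧ ∪ ⟦ C ⟧
    ND⊆X∪C {w} w∈ND =
      decidable-stable ((X? ∪? (_∈? C)) w)
                       (component-neighbours-outside G D-component w∈ND)

    V′∖X′⊆D : V′ ∖ X′ ⊆ ⟦ D ⟧
    V′∖X′⊆D (inj₂ w∈X′ , w∉X′)              = ⊥-elim (w∉X′ w∈X′)
    V′∖X′⊆D (inj₁ (inj₂ w∈D , _) , _)       = w∈D
    V′∖X′⊆D (inj₁ (inj₁ w∈ND , w∉C) , w∉X′) with ND⊆X∪C w∈ND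
    ... | inj₁ w∈X = ⊥-elim (w∉X′ (inj₂ w∈ND , w∈X , w∉C))
    ... | inj₂ w∈C = ⊥-elim (w∉C w∈C)

    interior⊆X′ : interior ⊆ X′
    interior⊆X′ {v} v∈int@(v∈X , v∉δ₁) = inj₁ v∈int , v∈X , v∉C
      where
      v∉C : v ∉ ⟦ C ⟧
      v∉C v∈C with C⊆ v∈C
      ... | inj₁ v∉X = v∉X v∈X
      ... | inj₂ v∈δ₁ = v∉δ₁ v∈δ₁

    interior′≐interior : X′ ∖ δ₁X′ ≐ interior
    interior′≐interior = interior′⊆interior , interior⊆interior′
      where
      interior′⊆interior : X′ ∖ δ₁X′ ⊆ interior
      interior′⊆interior ((inj₁ v∈int , _) , _) = v∈int
      interior′⊆interior (v∈X′@(inj₂ (_ , u , u∈D , vu) , _) , v∉δ₁′) =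
        ⊥-elim (v∉δ₁′ (v∈X′ , u , inj₁ (inj₂ u∈D , D∩C=∅ u∈D) ,
                       (λ u∈X′ → D∩X=∅ u∈D (proj₁ (proj₂ u∈X′))) , vu))

      interior⊆interior′ : interior ⊆ X′ ∖ δ₁X′
      interior⊆interior′ v∈int = interior⊆X′ v∈int ,
        λ { (_ , u , u∈V′ , u∉X′ , vu) →
              D∩X=∅ (V′∖X′⊆D (u∈V′ , u∉X′))
                    (interior-neighbours-inside G X? v∈int tt vu) }

    δ₂X′⊆δ₂X : δ₂X′ ⊆ δ₂X
    δ₂X′⊆δ₂X = δ-mono G (λ _ → tt) interior′≐interior

    core⊆core′ : core ⊆ core′
    core⊆core′ (v∈X , v∉δ) with proj₂ interior′≐interior (v∈X , v∉δ ∘ inj₁)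
    ... | v∈X′ , v∉δ₁′ = v∈X′ , λ { (inj₁ v∈δ₁′) → v∉δ₁′ v∈δ₁′
                                  ; (inj₂ v∈δ₂′) → v∉δ (inj₂ (δ₂X′⊆δ₂X v∈δ₂′)) }

    core′⊆interior : core′ ⊆ interior
    core′⊆interior (v∈X′ , v∉δ′) = proj₁ interior′≐interior (v∈X′ , v∉δ′ ∘ inj₁)

    core⊆X′ : core ⊆ X′
    core⊆X′ v∈core = proj₁ (core⊆core′ v∈core)

    module X = Induced.Cooperative X-coop

    interior-reaches-core-in-X′ : ∀ {v} → v ∈ interior →
      ∃[ k ] (k ∈ core × WalkIn G X′ v k)
    interior-reaches-core-in-X′ v∈int =
      interior-reaches-core G X-coop δ₂X? core⊆X′ v∈int (interior⊆X′ v∈int)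

    X′-reaches-core : ∀ {v} → v ∈ X′ → ∃[ k ] (k ∈ core × WalkIn G X′ v k)
    X′-reaches-core {v} v∈X′@(_ , v∈X , _) with δ? G U? X? v
    ... | no v∉δ₁  = interior-reaches-core-in-X′ (v∈X , v∉δ₁)
    ... | yes v∈δ₁ =
      let u , u∈int , vu = X.coop₁ v∈δ₁
          k , k∈core , uk = interior-reaches-core-in-X′ u∈int
      in  k , k∈core , step v∈X′ vu uk

    core′-reaches-core : ∀ {v} → v ∈ core′ → ∃[ k ] (k ∈ core × WalkIn G core′ v k)
    core′-reaches-core v∈core′ = interior-reaches-core G X-coop δ₂X? core⊆core′
                                                       (core′⊆interior v∈core′) v∈core′

  X′-cooperative : Induced.Cooperative G V′ X′
  X′-cooperative = record
    { inside    = inj₂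
    ; connected = connected-via-hub G X.coreConn core⊆X′ X′-reaches-core
    ; coop₁     = coop₁
    ; coop₂     = λ v∈δ₂′ → let k , k∈core , vk = X.coop₂ (δ₂X′⊆δ₂X v∈δ₂′)
                            in  k , core⊆core′ k∈core , vk
    ; coreConn  = connected-via-hub G X.coreConn core⊆core′ core′-reaches-core
    }
    where
    coop₁ : ∀ {v} → v ∈ δ₁X′ → ∃[ u ] (u ∈ X′ ∖ δ₁X′ × Adj G v u)
    coop₁ ((_ , v∈X , _) , u , u∈V′ , u∉X′ , vu) =
      let u∉X = D∩X=∅ (V′∖X′⊆D (u∈V′ , u∉X′))
          w , w∈int , vw = X.coop₁ (v∈X , u , tt , u∉X , vu)
      in  w , proj₂ interior′≐interior w∈int , vw

lemma5p5 : ∀ {n} (G : Graph n) (X C D : Subset n) →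
    CooperativeIn G ⟦ X ⟧ →
    ⟦ C ⟧ ⊆ ∁ ⟦ X ⟧ ∪ Induced.δ₁ G U ⟦ X ⟧ →
    IsComponent G (∁ (⟦ X ⟧ ∪ ⟦ C ⟧)) ⟦ D ⟧ →
    ¬ Anticomplete G ⟦ D ⟧ (⟦ X ⟧ ∖ ⟦ C ⟧) →
    let X′ = ((⟦ X ⟧ ∖ Induced.δ₁ G U ⟦ X ⟧) ∪ N G ⟦ D ⟧) ∩ (⟦ X ⟧ ∖ ⟦ C ⟧)
    in Induced.Cooperative G ((N[_] G ⟦ D ⟧ ∖ ⟦ C ⟧) ∪ X′) X′
lemma5p5 G X C D X-coop C⊆ D-component _ = X′-cooperative G X C D X-coop C⊆ D-component
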